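{- Let $H$ be a weighted hypergraph (every vertex in some hyperedge, every hyperedge with non-empty support) whose spectral decomposition is $\{(V_1,E_1),\dots,(V_k,E_k)\}$ with densities $\alpha_1>\dots>\alpha_k>0$. Then $\{(E_k,V_k),\dots,(E_1,V_1)\}$ is the spectral decomposition of the dual weighted hypergraph $H^*$, with densities $\alpha_k^{ -1}>\dots>\alpha_1^{ -1}>0$.
   Context: A weighted hypergraph $H=(V,E,\mathrm{supp})$ has finite vertex set $V$, finite hyperedge set $E$, support map $\mathrm{supp}:E\to\mathcal P(V)$ and positive weights on vertices and hyperedges; $\mathrm{wt}$ of a set is the sum of weights. A subgraph is a pair $(V',E')$, $V'\subset V$, $E'\subset E$, with $\mathrm{supp}(e)\subset V'$ for all $e\in E'$; its density is $\mathrm{wt}(E')/\mathrm{wt}(V')$. A quotient hypergraph is a pair $(V'',E'')$ such that every hyperedge of $H$ whose support meets $V''$ lies in $E''$, with support $\mathrm{supp}(e)\cap V''$; for a subgraph $(V',E')$, the pair $(V\setminus V',E\setminus E')$ is a quotient hypergraph. In any weighted hypergraph there is a unique subgraph of maximum density that is maximal under componentwise inclusion. The spectral decomposition of $H$ is the partition $V=V_{1}\sqcup\dots\sqcup V_{k}$, $E=E_{1}\sqcup\dots\sqcup E_{k}$ defined inductively: $(V_t,E_t)$ is the maximal subgraph of maximum density $\alpha_t$ in the quotient hypergraph $(V\setminus\bigcup_{r<t}V_r,\,E\setminus\bigcup_{r<t}E_r)$, $t=1,\dots,k$. The dual hypergraph $H^*$ has vertex set $E$ and hyperedge set $V$, with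 $e\in\mathrm{supp}^*(v)$ iff $v\in\mathrm{supp}(e)$; the weight of each element is the same as in $H$ (vertex weights of $H$ become hyperedge weights of $H^*$ and vice versa).
   Formalization: The vertex and hyperedge weights of $H$ are positive rationals. -}

module Defs where

open import Data.Nat using (ℕ; zero; suc)
open import Data.Fin using (Fin; zero; suc)
open import Data.Fin.Subset using (Subset; _∈_; _⊆_; _─_; Nonempty; ⊤; ⊥)
open import Data.Vec using (Vec; []; _∷_; tabulate; lookup)
open import Data.Bool using (Bool; true; false; if_then_else_)
open import Data.Rational using (ℚ; 0ℚ; _+_; _*_; _<_; _≤_; 1/_; _≟_; ≢-nonZero)
open import Data.Product using (Σ; ∃; _×_; _,_)
open import Data.List using (List; []; _∷_; map; reverse)
open import Data.List.Relation.Unary.All using (All)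
open import Data.Unit using () renaming (⊤ to Unit)
open import Relation.Nullary using (yes; no)
open import Relation.Binary.PropositionalEquality using (_≡_)

record Hypergraph : Set where
  field
    n    : ℕ
    m    : ℕ
    supp : Fin m → Subset n
    wV   : Fin n → ℚ
    wE   : Fin m → ℚ
open Hypergraph public

PositiveWeights : Hypergraph → Set
PositiveWeights H = (∀ v → 0ℚ < wV H v) × (∀ e → 0ℚ < wE H e)

wt : ∀ {k} → (Fin k → ℚ) → Subset k → ℚ
wt {zero}  w []      = 0ℚ
wt {suc k} w (b ∷ s) = (if b then w zero else 0ℚ) + wt (λ i → w (suc i)) s

-- Dual hypergraph: vertices = hyperedges of H, hyperedges = vertices of H,
-- e ∈ supp*(v) iff v ∈ supp(e); weights carried along.
dual : Hypergraph → Hypergraph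
dual H = record
  { n    = m H
  ; m    = n H
  ; supp = λ v → tabulate (λ e → lookup (supp H e) v)
  ; wV   = wE H
  ; wE   = wV H
  }

-- (A , B) is a subgraph of the quotient hypergraph (V'' , E'') of H,
-- where hyperedges e ∈ E'' have support supp(e) ∩ V''.
IsSubgraphOf : (H : Hypergraph) → Subset (n H) → Subset (m H)
             → Subset (n H) → Subset (m H) → Set
IsSubgraphOf H V'' E'' A B =
  A ⊆ V'' × B ⊆ E'' ×
  (∀ {e} → e ∈ B → ∀ {v} → v ∈ supp H e → v ∈ V'' → v ∈ A)

-- (A , B) has density α, i.e. A nonempty and wt(B)/wt(A) = α
-- (written without division as wt(B) = α * wt(A), wt(A) > 0).
HasDensity : (H : Hypergraph) → Subset (n H) → Subset (m H) → ℚ → Set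
HasDensity H A B α = Nonempty A × 0ℚ < wt (wV H) A × wt (wE H) B ≡ α * wt (wV H) A

IsMaxDensity : (H : Hypergraph) → Subset (n H) → Subset (m H)
             → Subset (n H) → Subset (m H) → ℚ → Set
IsMaxDensity H V'' E'' A B α =
  IsSubgraphOf H V'' E'' A B × HasDensity H A B α ×
  (∀ A' B' → IsSubgraphOf H V'' E'' A' B' → Nonempty A' →
     wt (wE H) B' ≤ α * wt (wV H) A')

IsMaximalMaxDensity : (H : Hypergraph) → Subset (n H) → Subset (m H)
                    → Subset (n H) → Subset (m H) → ℚ → Set
IsMaximalMaxDensity H V'' E'' A B α =
  IsMaxDensity H V'' E'' A B α ×
  (∀ A' B' → IsMaxDensity H V'' E'' A' B' α → A ⊆ A' → B ⊆ B' →
     A' ≡ A × B' ≡ B)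

Piece : Hypergraph → Set
Piece H = Subset (n H) × Subset (m H) × ℚ

SpecDecFrom : (H : Hypergraph) → Subset (n H) → Subset (m H) → List (Piece H) → Set
SpecDecFrom H V'' E'' []                = V'' ≡ ⊥ × E'' ≡ ⊥
SpecDecFrom H V'' E'' ((A , B , α) ∷ L) =
  IsMaximalMaxDensity H V'' E'' A B α × SpecDecFrom H (V'' ─ A) (E'' ─ B) L

SpectralDecomposition : (H : Hypergraph) → List (Piece H) → Set
SpectralDecomposition H L = SpecDecFrom H ⊤ ⊤ L

densities : (H : Hypergraph) → List (Piece H) → List ℚ
densities H = map (λ { (_ , _ , α) → α })

StrictlyDecreasing : List ℚ → Set
StrictlyDecreasing []           = Unit
StrictlyDecreasing (x ∷ [])     = Unit
StrictlyDecreasing (x ∷ y ∷ xs) = y < x × StrictlyDecreasing (y ∷ xs)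

-- Multiplicative inverse on ℚ (totalised by 0⁻¹ = 0; only used for α > 0).
inv : ℚ → ℚ
inv p with p ≟ 0ℚ
... | yes _  = 0ℚ
... | no p≢0 = 1/_ p {{≢-nonZero p≢0}}

dualPiece : ∀ {H} → Piece H → Piece (dual H)
dualPiece (A , B , α) = (B , A , inv α)

{-# OPTIONS --safe #-}
-- Let (V_k , E_k) be the last piece, of least density α_k. If (E′ , V′) is a subgraph of H*,
-- then for each t, (V_t ∖ V′ , E_t ∖ E′) is a subgraph of the t-th quotient, so
-- wt(E′ ∩ E_t) ≥ α_t wt(V′ ∩ V_t). Summing over t gives wt(E′) ≥ α_k wt(V′), and since the
-- earlier pieces are strictly denser, equality forces V′ ⊆ V_k and E′ ⊆ E_k. So (E_k , V_k)
-- is the maximal subgraph of H* of maximum density α_k⁻¹. Removing it from H* corresponds to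
-- dropping the last piece of H, and induction on the number of pieces concludes.
module Submission where

open import Defs
open import Data.Fin.Subset using (_∈_; Nonempty)
open import Data.Rational using (0ℚ; _<_)
open import Data.Product using (∃; _×_)
open import Data.List using (List; map; reverse)
open import Data.List.Relation.Unary.All using (All)

open import Algebra.Bundles using (CommutativeMonoid)
open import Data.Bool using (true; false)
open import Data.Fin using (Fin; zero; suc)
open import Data.Fin.Subset using (Subset; _∉_; _⊆_; _─_; _∩_; _∪_; ⁅_⁆; Empty; ⊤; ⊥; inside; outside)
open import Data.Fin.Subset.Properties
  using ( Empty-unique; nonempty?; _∈?_; ∉⊥; ∈⊤; ⊆-antisym; p∩q⊆q; x∈p∩q⁺; x∈p∩q⁻; ∩-comm
        ; p⊆p∪q; q⊆p∪q; x∈p∪q⁻; x∈⁅x⁆; x∈⁅y⁆⇒x≡y; x∈p∧x∉q⇒x∈p─q; p─q⊆p; p─q─r≡p─r─q)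
open import Data.List using ([]; _∷_; _∷ʳ_)
open import Data.List.Properties using (map-++; map-∘; reverse-++; reverse-map)
open import Data.List.Relation.Unary.All using ([]; _∷_)
import Data.List.Relation.Unary.All as All
open import Data.List.Relation.Unary.All.Properties using (∷ʳ⁺; ∷ʳ⁻; map⁺)
open import Data.List.Relation.Unary.Any.Properties using (reverse⁻)
open import Data.List.Reverse using (Reverse; []; _∶_∶ʳ_; reverseView)
open import Data.Nat using (ℕ; zero; suc)
open import Data.Product using (_,_; proj₁; proj₂)
open import Data.Sum using (inj₁; inj₂)
open import Data.Rational using (ℚ; 1ℚ; _+_; _*_; -_; _≤_; 1/_; _≟_; NonNegative; positive; nonNegative)
open import Data.Rational.Properties
open import Data.Unit using (tt)
open import Data.Vec using ([]; _∷_; lookup)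
open import Data.Vec.Properties using ([]=⇒lookup; lookup⇒[]=; lookup∘tabulate)
open import Data.Vec.Base using (here; there)
open import Relation.Binary.PropositionalEquality
open import Relation.Nullary using (¬_; yes; no; contradiction)

open import Algebra.Properties.CommutativeSemigroup
  (CommutativeMonoid.commutativeSemigroup +-0-commutativeMonoid) using (interchange)

private variable
  p q r s α β : ℚ

-- Arithmetic in ℚ

+-cancelʳ-≤ : ∀ r → p + r ≤ q + r → p ≤ q
+-cancelʳ-≤ {p} {q} r h = subst₂ _≤_ (+-r-r p) (+-r-r q) (+-monoˡ-≤ (- r) h)
  where
  open ≡-Reasoning
  +-r-r : ∀ x → x + r + - r ≡ x
  +-r-r x = begin
    x + r + - r    ≡⟨ +-assoc x r (- r) ⟩
    x + (r + - r)  ≡⟨ cong (x +_) (+-inverseʳ r) ⟩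
    x + 0ℚ         ≡⟨ +-identityʳ x ⟩
    x              ∎

+-cancelˡ-≤ : ∀ r → r + p ≤ r + q → p ≤ q
+-cancelˡ-≤ {p} {q} r h = +-cancelʳ-≤ r (subst₂ _≤_ (+-comm r p) (+-comm r q) h)

+-mono-≤-equality : p ≤ q → r ≤ s → p + r ≡ q + s → p ≡ q × r ≡ s
+-mono-≤-equality {p} {q} {r} {s} p≤q r≤s eq =
  ≤-antisym p≤q (+-cancelʳ-≤ r (begin
    q + r  ≤⟨ +-monoʳ-≤ q r≤s ⟩
    q + s  ≡⟨ eq ⟨
    p + r  ∎)) ,
  ≤-antisym r≤s (+-cancelˡ-≤ p (begin
    p + s  ≤⟨ +-monoˡ-≤ s p≤q ⟩
    q + s  ≡⟨ eq ⟨
    p + r  ∎))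
  where open ≤-Reasoning

+-cong-interchange : ∀ p₁ p₂ q₁ q₂ → p ≡ p₁ + p₂ → q ≡ q₁ + q₂ → p + q ≡ (p₁ + q₁) + (p₂ + q₂)
+-cong-interchange p₁ p₂ q₁ q₂ refl refl = interchange p₁ p₂ q₁ q₂

*-complement-≤ : ∀ α → r + s ≡ α * (p + q) → s ≤ α * q → α * p ≤ r
*-complement-≤ {r} {s} {p} {q} α eq s≤αq = +-cancelʳ-≤ (α * q) (begin
  α * p + α * q  ≡⟨ *-distribˡ-+ α p q ⟨
  α * (p + q)    ≡⟨ eq ⟨
  r + s          ≤⟨ +-monoʳ-≤ r s≤αq ⟩
  r + α * q      ∎)
  where open ≤-Reasoning

β<α⇒α*p≤β*p⇒p≡0 : β < α → 0ℚ ≤ p → α * p ≤ β * p → p ≡ 0ℚ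
β<α⇒α*p≤β*p⇒p≡0 {β} {α} {p} β<α 0≤p αp≤βp = ≤-antisym (≮⇒≥ p≯0) 0≤p
  where
  p≯0 : ¬ (0ℚ < p)
  p≯0 0<p = <-irrefl refl (<-≤-trans (*-monoˡ-<-pos p {{positive 0<p}} β<α) αp≤βp)

inv-≡-1/ : (α>0 : 0ℚ < α) → inv α ≡ (1/ α) {{pos⇒nonZero α {{positive α>0}}}}
inv-≡-1/ {α} α>0 with α ≟ 0ℚ
... | yes α≡0 = contradiction α>0 (<-irrefl (sym α≡0))
... | no _    = refl

inv-pos : 0ℚ < α → 0ℚ < inv α
inv-pos {α} α>0 rewrite inv-≡-1/ α>0 = positive⁻¹ _ {{1/pos⇒pos α {{positive α>0}}}}

inv-inverseˡ : 0ℚ < α → inv α * α ≡ 1ℚ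
inv-inverseˡ {α} α>0 rewrite inv-≡-1/ α>0 = *-inverseˡ α {{pos⇒nonZero α {{positive α>0}}}}

inv-cancelˡ : 0ℚ < α → ∀ p → inv α * (α * p) ≡ p
inv-cancelˡ {α} α>0 p = begin
  inv α * (α * p)  ≡⟨ *-assoc (inv α) α p ⟨
  inv α * α * p    ≡⟨ cong (_* p) (inv-inverseˡ α>0) ⟩
  1ℚ * p           ≡⟨ *-identityˡ p ⟩
  p                ∎
  where open ≡-Reasoning

inv-cancelʳ : 0ℚ < α → ∀ p → α * (inv α * p) ≡ p
inv-cancelʳ {α} α>0 p = begin
  α * (inv α * p)  ≡⟨ *-assoc α (inv α) p ⟨
  α * inv α * p    ≡⟨ cong (_* p) (*-comm α (inv α)) ⟩
  inv α * α * p    ≡⟨ *-assoc (inv α) α p ⟩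
  inv α * (α * p)  ≡⟨ inv-cancelˡ α>0 p ⟩
  p                ∎
  where open ≡-Reasoning

inv-antitone : 0ℚ < p → p < q → inv q < inv p
inv-antitone {p} {q} p>0 p<q = *-cancelʳ-<-nonNeg p {{nonNegative (<⇒≤ p>0)}} (begin-strict
  inv q * p  <⟨ *-monoʳ-<-pos (inv q) {{positive (inv-pos q>0)}} p<q ⟩
  inv q * q  ≡⟨ inv-inverseˡ q>0 ⟩
  1ℚ         ≡⟨ inv-inverseˡ p>0 ⟨
  inv p * p  ∎)
  where
  open ≤-Reasoning
  q>0 : 0ℚ < q
  q>0 = <-trans p>0 p<q

-- Sorted lists of densities

StrictlyDecreasing-∷ʳ⁻ : ∀ xs x → StrictlyDecreasing (xs ∷ʳ x) → StrictlyDecreasing xs × All (x <_) xs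
StrictlyDecreasing-∷ʳ⁻ []           x _          = tt , []
StrictlyDecreasing-∷ʳ⁻ (y ∷ [])     x (x<y , _)  = tt , x<y ∷ []
StrictlyDecreasing-∷ʳ⁻ (y ∷ z ∷ zs) x (z<y , dec) with StrictlyDecreasing-∷ʳ⁻ (z ∷ zs) x dec
... | dec′ , x<z ∷ x<zs = (z<y , dec′) , <-trans x<z z<y ∷ x<z ∷ x<zs

StrictlyDecreasing-∷⁺ : ∀ x xs → All (_< x) xs → StrictlyDecreasing xs → StrictlyDecreasing (x ∷ xs)
StrictlyDecreasing-∷⁺ x []       _         _   = tt
StrictlyDecreasing-∷⁺ x (y ∷ ys) (y<x ∷ _) dec = y<x , dec

All-reverse : ∀ {P : ℚ → Set} {xs} → All P xs → All P (reverse xs)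
All-reverse ps = All.tabulate (λ x∈ → All.lookup ps (reverse⁻ x∈))

reverse-map-∷ʳ : ∀ {A B : Set} (f : A → B) xs x → reverse (map f (xs ∷ʳ x)) ≡ f x ∷ reverse (map f xs)
reverse-map-∷ʳ f xs x = trans (cong reverse (map-++ f xs (x ∷ []))) (reverse-++ (map f xs) (f x ∷ []))

inv-reverse-StrictlyDecreasing : ∀ {xs} → Reverse xs → StrictlyDecreasing xs → All (0ℚ <_) xs →
                                 StrictlyDecreasing (reverse (map inv xs))
inv-reverse-StrictlyDecreasing [] _ _ = tt
inv-reverse-StrictlyDecreasing (xs ∶ r ∶ʳ x) dec pos
  rewrite reverse-map-∷ʳ inv xs x
  with StrictlyDecreasing-∷ʳ⁻ xs x dec | ∷ʳ⁻ pos
... | dec′ , x<xs | pos′ , x>0 =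
  StrictlyDecreasing-∷⁺ (inv x) _ (All-reverse (map⁺ (All.map (inv-antitone x>0) x<xs)))
    (inv-reverse-StrictlyDecreasing r dec′ pos′)

-- Subsets and their weights

private variable
  k : ℕ
  x : Fin k
  P Q R : Subset k

x∈p─q⇒x∉q : x ∈ P ─ Q → x ∉ Q
x∈p─q⇒x∉q {P = _ ∷ P} {Q = inside  ∷ Q} (there x∈) (there x∈Q) = x∈p─q⇒x∉q {Q = Q} x∈ x∈Q
x∈p─q⇒x∉q {P = _ ∷ P} {Q = outside ∷ Q} (there x∈) (there x∈Q) = x∈p─q⇒x∉q {Q = Q} x∈ x∈Q

x∈q⇒q─r≡⊥⇒x∈r : x ∈ Q → Q ─ R ≡ ⊥ → x ∈ R
x∈q⇒q─r≡⊥⇒x∈r {x = x} {R = R} x∈Q Q─R≡⊥ with x ∈? R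
... | yes x∈R = x∈R
... | no  x∉R = contradiction (subst (x ∈_) Q─R≡⊥ (x∈p∧x∉q⇒x∈p─q x∈Q x∉R)) ∉⊥

x∈p─q⇒x∈p : x ∈ P ─ Q → x ∈ P
x∈p─q⇒x∈p {P = P} {Q} = p─q⊆p P Q

─-monoˡ-⊆ : P ⊆ Q → P ─ R ⊆ Q ─ R
─-monoˡ-⊆ P⊆Q x∈ = x∈p∧x∉q⇒x∈p─q (P⊆Q (x∈p─q⇒x∈p x∈)) (x∈p─q⇒x∉q x∈)

⊆-─-swap : P ⊆ R → Q ⊆ R ─ P → P ⊆ R ─ Q
⊆-─-swap P⊆R Q⊆R─P x∈P = x∈p∧x∉q⇒x∈p─q (P⊆R x∈P) (λ x∈Q → x∈p─q⇒x∉q (Q⊆R─P x∈Q) x∈P)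

Empty∩⇒─⊆⇒⊆ : Empty (P ∩ Q) → P ─ Q ⊆ R → P ⊆ R
Empty∩⇒─⊆⇒⊆ {Q = Q} P∩Q≡∅ P─Q⊆R {x} x∈P with x ∈? Q
... | yes x∈Q = contradiction (x , x∈p∩q⁺ (x∈P , x∈Q)) P∩Q≡∅
... | no  x∉Q = P─Q⊆R (x∈p∧x∉q⇒x∈p─q x∈P x∉Q)

wt-⊥ : ∀ (w : Fin k → ℚ) → wt w ⊥ ≡ 0ℚ
wt-⊥ {zero}  w = refl
wt-⊥ {suc k} w = trans (+-identityˡ _) (wt-⊥ (λ i → w (suc i)))

wt-Empty : ∀ (w : Fin k → ℚ) → Empty P → wt w P ≡ 0ℚ
wt-Empty w P≡∅ = trans (cong (wt w) (Empty-unique P≡∅)) (wt-⊥ w)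

wt-split : ∀ (w : Fin k → ℚ) P Q → wt w P ≡ wt w (P ∩ Q) + wt w (P ─ Q)
wt-split w [] [] = sym (+-identityˡ 0ℚ)
wt-split w (b ∷ P) (c ∷ Q) = split-∷ b c
  where
  w′ : Fin _ → ℚ
  w′ i = w (suc i)
  w∩ w─ : ℚ
  w∩ = wt w′ (P ∩ Q)
  w─ = wt w′ (P ─ Q)
  split-∷ : ∀ b c → wt w (b ∷ P) ≡ wt w ((b ∷ P) ∩ (c ∷ Q)) + wt w ((b ∷ P) ─ (c ∷ Q))
  ih : wt w′ P ≡ w∩ + w─
  ih = wt-split w′ P Q
  split-∷ true  true  = +-cong-interchange (w zero) 0ℚ w∩ w─ (sym (+-identityʳ (w zero))) ih
  split-∷ true  false = +-cong-interchange 0ℚ (w zero) w∩ w─ (sym (+-identityˡ (w zero))) ih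
  split-∷ false true  = +-cong-interchange 0ℚ 0ℚ w∩ w─ (sym (+-identityˡ 0ℚ)) ih
  split-∷ false false = +-cong-interchange 0ℚ 0ℚ w∩ w─ (sym (+-identityˡ 0ℚ)) ih

wt-nonNeg : ∀ {w : Fin k → ℚ} → (∀ i → 0ℚ ≤ w i) → ∀ P → 0ℚ ≤ wt w P
wt-nonNeg w≥0 []          = ≤-refl
wt-nonNeg w≥0 (true  ∷ P) = +-mono-≤ (w≥0 zero) (wt-nonNeg (λ i → w≥0 (suc i)) P)
wt-nonNeg w≥0 (false ∷ P) = +-mono-≤ ≤-refl (wt-nonNeg (λ i → w≥0 (suc i)) P)

wt-pos : ∀ {w : Fin k → ℚ} → (∀ i → 0ℚ < w i) → Nonempty P → 0ℚ < wt w P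
wt-pos {P = true  ∷ P} w>0 _ = +-mono-<-≤ (w>0 zero) (wt-nonNeg (λ i → <⇒≤ (w>0 (suc i))) P)
wt-pos {P = false ∷ P} w>0 (suc x , there x∈P) = +-mono-≤-< ≤-refl (wt-pos (λ i → w>0 (suc i)) (x , x∈P))

wt-≡0⇒Empty : ∀ {w : Fin k → ℚ} → (∀ i → 0ℚ < w i) → wt w P ≡ 0ℚ → Empty P
wt-≡0⇒Empty w>0 wt≡0 ne = <-irrefl (sym wt≡0) (wt-pos w>0 ne)

wt-pos⇒Nonempty : ∀ (w : Fin k → ℚ) → 0ℚ < wt w P → Nonempty P
wt-pos⇒Nonempty {P = P} w wt>0 with nonempty? P
... | yes ne = ne
... | no  P≡∅ = contradiction (subst (0ℚ <_) (wt-Empty w P≡∅) wt>0) (<-irrefl refl)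

wt-<-⊂ : ∀ {w : Fin k → ℚ} → (∀ i → 0ℚ < w i) → P ⊆ Q → x ∈ Q → x ∉ P → wt w P < wt w Q
wt-<-⊂ {P = P} {Q = Q} {x = x} {w = w} w>0 P⊆Q x∈Q x∉P = begin-strict
  wt w P                          ≡⟨ +-identityʳ (wt w P) ⟨
  wt w P + 0ℚ                     <⟨ +-monoʳ-< (wt w P) (wt-pos w>0 (x , x∈p∧x∉q⇒x∈p─q x∈Q x∉P)) ⟩
  wt w P + wt w (Q ─ P)           ≡⟨ cong (λ S → wt w S + wt w (Q ─ P)) Q∩P≡P ⟨
  wt w (Q ∩ P) + wt w (Q ─ P)     ≡⟨ wt-split w Q P ⟨
  wt w Q                          ∎
  where
  open ≤-Reasoning
  Q∩P≡P : Q ∩ P ≡ P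
  Q∩P≡P = ⊆-antisym (p∩q⊆q Q P) (λ x∈P → x∈p∩q⁺ (P⊆Q x∈P , x∈P))

-- Subgraphs of quotient hypergraphs

module _ (G : Hypergraph) where
  private variable
    v : Fin (n G)
    e : Fin (m G)
    X A A′ : Subset (n G)
    Y B B′ : Subset (m G)

  lookup-supp-dual : ∀ v e → lookup (supp (dual G) v) e ≡ lookup (supp G e) v
  lookup-supp-dual v = lookup∘tabulate (λ e → lookup (supp G e) v)

  ∈-supp-dual⁺ : v ∈ supp G e → e ∈ supp (dual G) v
  ∈-supp-dual⁺ {v} {e} v∈ = lookup⇒[]= e _ (trans (lookup-supp-dual v e) ([]=⇒lookup v∈))

  ∈-supp-dual⁻ : e ∈ supp (dual G) v → v ∈ supp G e
  ∈-supp-dual⁻ {e} {v} e∈ = lookup⇒[]= v _ (trans (sym (lookup-supp-dual v e)) ([]=⇒lookup e∈))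

  IsSubgraphOf-shrink : ∀ {X′ Y′} → A ⊆ X′ → B ⊆ Y′ → X′ ⊆ X →
                        IsSubgraphOf G X Y A B → IsSubgraphOf G X′ Y′ A B
  IsSubgraphOf-shrink A⊆X′ B⊆Y′ X′⊆X (_ , _ , closed) =
    A⊆X′ , B⊆Y′ , λ e∈ v∈e v∈X′ → closed e∈ v∈e (X′⊆X v∈X′)

  IsSubgraphOf-∪⁅⁆ : IsSubgraphOf G X Y A B → e ∈ Y → (∀ {v} → v ∈ supp G e → v ∈ X → v ∈ A) →
                     IsSubgraphOf G X Y A (B ∪ ⁅ e ⁆)
  IsSubgraphOf-∪⁅⁆ {X = X} {Y = Y} {A = A} {B = B} {e = e} (A⊆X , B⊆Y , closed) e∈Y e-closed =
    A⊆X , B⁺⊆Y , closed⁺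
    where
    B⁺⊆Y : B ∪ ⁅ e ⁆ ⊆ Y
    B⁺⊆Y e′∈ with x∈p∪q⁻ B ⁅ e ⁆ e′∈
    ... | inj₁ e′∈B   = B⊆Y e′∈B
    ... | inj₂ e′∈⁅e⁆ rewrite x∈⁅y⁆⇒x≡y e e′∈⁅e⁆ = e∈Y
    closed⁺ : ∀ {e′} → e′ ∈ B ∪ ⁅ e ⁆ → ∀ {v} → v ∈ supp G e′ → v ∈ X → v ∈ A
    closed⁺ e′∈ with x∈p∪q⁻ B ⁅ e ⁆ e′∈
    ... | inj₁ e′∈B   = closed e′∈B
    ... | inj₂ e′∈⁅e⁆ rewrite x∈⁅y⁆⇒x≡y e e′∈⁅e⁆ = e-closed

  IsSubgraphOf-─ : IsSubgraphOf G X Y A′ B′ → IsSubgraphOf G (X ─ A) (Y ─ B) (A′ ─ A) (B′ ─ B)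
  IsSubgraphOf-─ (A′⊆X , B′⊆Y , closed) =
    ─-monoˡ-⊆ A′⊆X , ─-monoˡ-⊆ B′⊆Y ,
    λ e∈ v∈ v∈X─A → x∈p∧x∉q⇒x∈p─q (closed (x∈p─q⇒x∈p e∈) v∈ (x∈p─q⇒x∈p v∈X─A)) (x∈p─q⇒x∉q v∈X─A)

module _ (H : Hypergraph) where
  private variable
    X A A₁ A′ : Subset (n H)
    Y B B₁ B′ : Subset (m H)
    L : List (Piece H)

  NonemptySupports : Subset (n H) → Subset (m H) → Set
  NonemptySupports X Y = ∀ {e} → e ∈ Y → Nonempty (supp H e ∩ X)

  Empty-subgraph : NonemptySupports X Y → IsSubgraphOf H X Y A B → Empty A → Empty B
  Empty-subgraph {X = X} supp≢∅ (_ , B⊆Y , closed) A≡∅ (e , e∈B) with supp≢∅ (B⊆Y e∈B)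
  ... | v , v∈ with x∈p∩q⁻ (supp H e) X v∈
  ...   | v∈e , v∈X = A≡∅ (v , closed e∈B v∈e v∈X)

  -- IsMaxDensity bounds only subgraphs with a vertex; nonempty supports cover the empty one.
  IsMaxDensity-bound : NonemptySupports X Y → IsMaxDensity H X Y A B α → IsSubgraphOf H X Y A′ B′ →
                       wt (wE H) B′ ≤ α * wt (wV H) A′
  IsMaxDensity-bound {α = α} {A′ = A′} {B′ = B′} supp≢∅ (_ , _ , bound) sub with nonempty? A′
  ... | yes ne  = bound _ _ sub ne
  ... | no A′≡∅ = ≤-reflexive (begin
    wt (wE H) B′        ≡⟨ wt-Empty (wE H) (Empty-subgraph supp≢∅ sub A′≡∅) ⟩
    0ℚ                  ≡⟨ *-zeroʳ α ⟨
    α * 0ℚ              ≡⟨ cong (α *_) (wt-Empty (wV H) A′≡∅) ⟨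
    α * wt (wV H) A′    ∎)
    where open ≡-Reasoning

  subgraph-─-dualSubgraph : IsSubgraphOf H X Y A B → IsSubgraphOf (dual H) Y X B′ A′ →
                            IsSubgraphOf H X Y (A ─ A′) (B ─ B′)
  subgraph-─-dualSubgraph (A⊆X , B⊆Y , closed) (_ , _ , closed′) =
    (λ v∈ → A⊆X (x∈p─q⇒x∈p v∈)) , (λ e∈ → B⊆Y (x∈p─q⇒x∈p e∈)) ,
    λ e∈ v∈e v∈X → x∈p∧x∉q⇒x∈p─q (closed (x∈p─q⇒x∈p e∈) v∈e v∈X)
      (λ v∈A′ → x∈p─q⇒x∉q e∈ (closed′ v∈A′ (∈-supp-dual⁺ H v∈e) (B⊆Y (x∈p─q⇒x∈p e∈))))

  dualSubgraph-∩-weight-≥ : NonemptySupports X Y → IsMaxDensity H X Y A B α →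
                            IsSubgraphOf (dual H) Y X B′ A′ →
                            α * wt (wV H) (A′ ∩ A) ≤ wt (wE H) (B′ ∩ B)
  dualSubgraph-∩-weight-≥ {A = A} {B = B} {α = α} {B′ = B′} {A′ = A′}
    supp≢∅ max@(sub , (_ , _ , wtB≡) , _) dsub =
    subst₂ (λ S T → α * wt (wV H) S ≤ wt (wE H) T) (∩-comm A A′) (∩-comm B B′)
      (*-complement-≤ α split (IsMaxDensity-bound {α = α} supp≢∅ max (subgraph-─-dualSubgraph sub dsub)))
    where
    split : wt (wE H) (B ∩ B′) + wt (wE H) (B ─ B′) ≡ α * (wt (wV H) (A ∩ A′) + wt (wV H) (A ─ A′))
    split = trans (sym (wt-split (wE H) B B′)) (trans wtB≡ (cong (α *_) (wt-split (wV H) A A′)))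

  subgraph-─⇒subgraph : IsSubgraphOf (dual H) Y X B A → IsSubgraphOf H (X ─ A) (Y ─ B) A′ B′ →
                        IsSubgraphOf H X Y A′ B′
  subgraph-─⇒subgraph (_ , _ , closed) (A′⊆X─A , B′⊆Y─B , closed′) =
    (λ v∈ → x∈p─q⇒x∈p (A′⊆X─A v∈)) , (λ e∈ → x∈p─q⇒x∈p (B′⊆Y─B e∈)) ,
    λ e∈B′ v∈e v∈X → closed′ e∈B′ v∈e (x∈p∧x∉q⇒x∈p─q v∈X (λ v∈A →
      x∈p─q⇒x∉q (B′⊆Y─B e∈B′) (closed v∈A (∈-supp-dual⁺ H v∈e) (x∈p─q⇒x∈p (B′⊆Y─B e∈B′)))))

  dualSubgraph-─⇒dualSubgraph : IsSubgraphOf H X Y A₁ B₁ → IsSubgraphOf (dual H) (Y ─ B₁) (X ─ A₁) B A →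
                                IsSubgraphOf (dual H) Y X B A
  dualSubgraph-─⇒dualSubgraph {Y = Y} {B₁ = B₁} {B = B} {A = A}
    (_ , _ , closed₁) (B⊆Y─B₁ , A⊆X─A₁ , closed) =
    (λ e∈ → x∈p─q⇒x∈p (B⊆Y─B₁ e∈)) , (λ v∈ → x∈p─q⇒x∈p (A⊆X─A₁ v∈)) , closed′
    where
    closed′ : ∀ {v} → v ∈ A → ∀ {e} → e ∈ supp (dual H) v → e ∈ Y → e ∈ B
    closed′ v∈A {e} e∈v e∈Y with e ∈? B₁
    ... | yes e∈B₁ = contradiction (closed₁ e∈B₁ (∈-supp-dual⁻ H e∈v) (x∈p─q⇒x∈p (A⊆X─A₁ v∈A)))
                                   (x∈p─q⇒x∉q (A⊆X─A₁ v∈A))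
    ... | no  e∉B₁ = closed v∈A e∈v (x∈p∧x∉q⇒x∈p─q e∈Y e∉B₁)

  NonemptySupports-─-dualSubgraph : NonemptySupports X Y → IsSubgraphOf (dual H) Y X B A →
                                    NonemptySupports (X ─ A) (Y ─ B)
  NonemptySupports-─-dualSubgraph {X = X} {A = A} supp≢∅ (_ , _ , closed) {e} e∈Y─B
    with supp≢∅ (x∈p─q⇒x∈p e∈Y─B)
  ... | v , v∈ with x∈p∩q⁻ (supp H e) X v∈
  ...   | v∈e , v∈X with v ∈? A
  ...     | yes v∈A = contradiction (closed v∈A (∈-supp-dual⁺ H v∈e) (x∈p─q⇒x∈p e∈Y─B)) (x∈p─q⇒x∉q e∈Y─B)
  ...     | no  v∉A = v , x∈p∩q⁺ (v∈e , x∈p∧x∉q⇒x∈p─q v∈X v∉A)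

  IsMaximalMaxDensity-─ : IsSubgraphOf (dual H) Y X B A → A₁ ⊆ X ─ A → B₁ ⊆ Y ─ B →
                          IsMaximalMaxDensity H X Y A₁ B₁ α →
                          IsMaximalMaxDensity H (X ─ A) (Y ─ B) A₁ B₁ α
  IsMaximalMaxDensity-─ dsub A₁⊆ B₁⊆ ((sub , density , bound) , maximal) =
    (IsSubgraphOf-shrink H A₁⊆ B₁⊆ x∈p─q⇒x∈p sub , density ,
     λ A′ B′ sub′ → bound A′ B′ (subgraph-─⇒subgraph dsub sub′)) ,
    λ A′ B′ (sub′ , density′ , _) → maximal A′ B′ (subgraph-─⇒subgraph dsub sub′ , density′ , bound)

  -- Spectral decompositions

  last-piece : SpecDecFrom H X Y (L ∷ʳ (A , B , α)) → IsSubgraphOf (dual H) Y X B A × HasDensity H A B α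
  last-piece {L = []} ((((A⊆X , B⊆Y , _) , density , _) , _) , _ , Y─B≡⊥) =
    (B⊆Y , A⊆X , λ _ _ e∈Y → x∈q⇒q─r≡⊥⇒x∈r e∈Y Y─B≡⊥) , density
  last-piece {L = _ ∷ L} (((sub₁ , _) , _) , rest) with last-piece {L = L} rest
  ... | dsub , density = dualSubgraph-─⇒dualSubgraph sub₁ dsub , density

  SpecDecFrom-∷ʳ⁻ : SpecDecFrom H X Y (L ∷ʳ (A , B , α)) → SpecDecFrom H (X ─ A) (Y ─ B) L
  SpecDecFrom-∷ʳ⁻ {L = []} (_ , done) = done
  SpecDecFrom-∷ʳ⁻ {X = X} {Y = Y} {L = (A₁ , B₁ , α₁) ∷ L} {A = A} {B = B}
    s@(max₁@(((A₁⊆X , B₁⊆Y , _) , _) , _) , rest) =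
    IsMaximalMaxDensity-─ {α = α₁} (proj₁ (last-piece {L = (A₁ , B₁ , α₁) ∷ L} s))
      (⊆-─-swap A₁⊆X A⊆X─A₁) (⊆-─-swap B₁⊆Y B⊆Y─B₁) max₁ ,
    subst₂ (λ X′ Y′ → SpecDecFrom H X′ Y′ L) (p─q─r≡p─r─q X A₁ A) (p─q─r≡p─r─q Y B₁ B)
      (SpecDecFrom-∷ʳ⁻ rest)
    where
    B⊆Y─B₁ : B ⊆ Y ─ B₁
    B⊆Y─B₁ = proj₁ (proj₁ (last-piece rest))
    A⊆X─A₁ : A ⊆ X ─ A₁
    A⊆X─A₁ = proj₁ (proj₂ (proj₁ (last-piece rest)))

  densities-∷ʳ : ∀ L {A B α} → densities H (L ∷ʳ (A , B , α)) ≡ densities H L ∷ʳ α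
  densities-∷ʳ L = map-++ _ L _

  densities-dual : ∀ L → densities (dual H) (reverse (map (dualPiece {H}) L)) ≡
                         reverse (map inv (densities H L))
  densities-dual L =
    trans (reverse-map _ (map (dualPiece {H}) L)) (cong reverse (trans (sym (map-∘ L)) (map-∘ L)))

  All-≤-densities-∷ʳ : All (α <_) (densities H L) → All (α ≤_) (densities H (L ∷ʳ (A , B , α)))
  All-≤-densities-∷ʳ {L = L} α<L = subst (All _) (sym (densities-∷ʳ L)) (∷ʳ⁺ (All.map <⇒≤ α<L) ≤-refl)

  module _ (pw : PositiveWeights H) where
    wV>0 : ∀ v → 0ℚ < wV H v
    wV>0 = proj₁ pw

    wE>0 : ∀ e → 0ℚ < wE H e
    wE>0 = proj₂ pw

    wtV-nonNeg : ∀ A → 0ℚ ≤ wt (wV H) A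
    wtV-nonNeg = wt-nonNeg (λ v → <⇒≤ (wV>0 v))

    NonemptySupports-─-maxDensity : NonemptySupports X Y → IsMaxDensity H X Y A B α →
                                    NonemptySupports (X ─ A) (Y ─ B)
    NonemptySupports-─-maxDensity {X = X} {A = A} {B = B} {α = α}
      supp≢∅ (sub , (A≢∅ , _ , wtB≡) , bound) {e} e∈Y─B
      with nonempty? (supp H e ∩ (X ─ A))
    ... | yes ne = ne
    -- Otherwise e could join the piece and raise its density above the maximum.
    ... | no  e∩X─A≡∅ = contradiction (<-≤-trans heavier bounded) (<-irrefl refl)
      where
      e-closed : ∀ {v} → v ∈ supp H e → v ∈ X → v ∈ A
      e-closed {v} v∈e v∈X with v ∈? A
      ... | yes v∈A = v∈A
      ... | no  v∉A = contradiction (v , x∈p∩q⁺ (v∈e , x∈p∧x∉q⇒x∈p─q v∈X v∉A)) e∩X─A≡∅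
      heavier : wt (wE H) B < wt (wE H) (B ∪ ⁅ e ⁆)
      heavier = wt-<-⊂ wE>0 (p⊆p∪q ⁅ e ⁆) (q⊆p∪q B ⁅ e ⁆ (x∈⁅x⁆ e)) (x∈p─q⇒x∉q e∈Y─B)
      bounded : wt (wE H) (B ∪ ⁅ e ⁆) ≤ wt (wE H) B
      bounded = begin
        wt (wE H) (B ∪ ⁅ e ⁆)  ≤⟨ bound A _ (IsSubgraphOf-∪⁅⁆ H sub (x∈p─q⇒x∈p e∈Y─B) e-closed) A≢∅ ⟩
        α * wt (wV H) A        ≡⟨ wtB≡ ⟨
        wt (wE H) B            ∎
        where open ≤-Reasoning

    dualSubgraph-weight-≥ : ∀ β → NonemptySupports X Y → SpecDecFrom H X Y L →
                            All (β ≤_) (densities H L) → IsSubgraphOf (dual H) Y X B′ A′ →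
                            β * wt (wV H) A′ ≤ wt (wE H) B′
    dualSubgraph-weight-≥ {L = []} {B′ = B′} {A′ = A′} β _ (refl , refl) _ (_ , A′⊆⊥ , _) = begin
      β * wt (wV H) A′  ≡⟨ cong (β *_) (wt-Empty (wV H) (λ (_ , v∈) → ∉⊥ (A′⊆⊥ v∈))) ⟩
      β * 0ℚ            ≡⟨ *-zeroʳ β ⟩
      0ℚ                ≤⟨ wt-nonNeg (λ e → <⇒≤ (wE>0 e)) B′ ⟩
      wt (wE H) B′      ∎
      where open ≤-Reasoning
    dualSubgraph-weight-≥ {L = (A , B , α) ∷ L} {B′ = B′} {A′ = A′}
      β supp≢∅ ((max , _) , rest) (β≤α ∷ β≤L) dsub = begin
      β * wt (wV H) A′                                 ≡⟨ cong (β *_) (wt-split (wV H) A′ A) ⟩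
      β * (wt (wV H) (A′ ∩ A) + wt (wV H) (A′ ─ A))    ≡⟨ *-distribˡ-+ β _ _ ⟩
      β * wt (wV H) (A′ ∩ A) + β * wt (wV H) (A′ ─ A)  ≤⟨ +-mono-≤ inPiece beyondPiece ⟩
      wt (wE H) (B′ ∩ B) + wt (wE H) (B′ ─ B)          ≡⟨ wt-split (wE H) B′ B ⟨
      wt (wE H) B′                                     ∎
      where
      open ≤-Reasoning
      inPiece : β * wt (wV H) (A′ ∩ A) ≤ wt (wE H) (B′ ∩ B)
      inPiece = ≤-trans (*-monoʳ-≤-nonNeg _ {{nonNegative (wtV-nonNeg (A′ ∩ A))}} β≤α)
                        (dualSubgraph-∩-weight-≥ {α = α} supp≢∅ max dsub)
      beyondPiece : β * wt (wV H) (A′ ─ A) ≤ wt (wE H) (B′ ─ B)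
      beyondPiece = dualSubgraph-weight-≥ β (NonemptySupports-─-maxDensity {α = α} supp≢∅ max) rest β≤L
                                          (IsSubgraphOf-─ (dual H) dsub)

    dualSubgraph-weight-≡⇒⊆ : NonemptySupports X Y → SpecDecFrom H X Y (L ∷ʳ (A , B , α)) →
                              All (α <_) (densities H L) → IsSubgraphOf (dual H) Y X B′ A′ →
                              α * wt (wV H) A′ ≡ wt (wE H) B′ → A′ ⊆ A × B′ ⊆ B
    dualSubgraph-weight-≡⇒⊆ {L = []} _ (_ , X─A≡⊥ , Y─B≡⊥) _ (B′⊆Y , A′⊆X , _) _ =
      (λ v∈ → x∈q⇒q─r≡⊥⇒x∈r (A′⊆X v∈) X─A≡⊥) , (λ e∈ → x∈q⇒q─r≡⊥⇒x∈r (B′⊆Y e∈) Y─B≡⊥)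
    dualSubgraph-weight-≡⇒⊆ {X = X} {Y = Y} {L = (A₁ , B₁ , α₁) ∷ L} {A = A} {B = B} {α = α}
      {B′ = B′} {A′ = A′} supp≢∅ ((max₁ , _) , rest) (α<α₁ ∷ α<L) dsub tight =
      Empty∩⇒─⊆⇒⊆ (wt-≡0⇒Empty wV>0 a₁≡0) (proj₁ beyond) ,
      Empty∩⇒─⊆⇒⊆ (wt-≡0⇒Empty wE>0 b₁≡0) (proj₂ beyond)
      where
      a₁ a₂ b₁ b₂ : ℚ
      a₁ = wt (wV H) (A′ ∩ A₁)
      a₂ = wt (wV H) (A′ ─ A₁)
      b₁ = wt (wE H) (B′ ∩ B₁)
      b₂ = wt (wE H) (B′ ─ B₁)
      supp≢∅′ : NonemptySupports (X ─ A₁) (Y ─ B₁)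
      supp≢∅′ = NonemptySupports-─-maxDensity {α = α₁} supp≢∅ max₁
      inPiece : α₁ * a₁ ≤ b₁
      inPiece = dualSubgraph-∩-weight-≥ {α = α₁} supp≢∅ max₁ dsub
      beyondPiece : α * a₂ ≤ b₂
      beyondPiece = dualSubgraph-weight-≥ α supp≢∅′ rest (All-≤-densities-∷ʳ {L = L} α<L)
                                          (IsSubgraphOf-─ (dual H) dsub)
      split : α * a₁ + α * a₂ ≡ b₁ + b₂
      split = begin
        α * a₁ + α * a₂   ≡⟨ *-distribˡ-+ α a₁ a₂ ⟨
        α * (a₁ + a₂)     ≡⟨ cong (α *_) (wt-split (wV H) A′ A₁) ⟨
        α * wt (wV H) A′  ≡⟨ tight ⟩
        wt (wE H) B′      ≡⟨ wt-split (wE H) B′ B₁ ⟩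
        b₁ + b₂           ∎
        where open ≡-Reasoning
      tightParts : α * a₁ ≡ b₁ × α * a₂ ≡ b₂
      tightParts = +-mono-≤-equality (≤-trans αa₁≤α₁a₁ inPiece) beyondPiece split
        where
        αa₁≤α₁a₁ : α * a₁ ≤ α₁ * a₁
        αa₁≤α₁a₁ = *-monoʳ-≤-nonNeg a₁ {{nonNegative (wtV-nonNeg _)}} (<⇒≤ α<α₁)
      a₁≡0 : a₁ ≡ 0ℚ
      a₁≡0 = β<α⇒α*p≤β*p⇒p≡0 α<α₁ (wtV-nonNeg _) (subst (α₁ * a₁ ≤_) (sym (proj₁ tightParts)) inPiece)
      b₁≡0 : b₁ ≡ 0ℚ
      b₁≡0 = trans (sym (proj₁ tightParts)) (trans (cong (α *_) a₁≡0) (*-zeroʳ α))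
      beyond : A′ ─ A₁ ⊆ A × B′ ─ B₁ ⊆ B
      beyond = dualSubgraph-weight-≡⇒⊆ supp≢∅′ rest α<L (IsSubgraphOf-─ (dual H) dsub) (proj₂ tightParts)

    last-piece-dual-maximal : NonemptySupports X Y → SpecDecFrom H X Y (L ∷ʳ (A , B , α)) →
                              All (α <_) (densities H L) → 0ℚ < α →
                              IsMaximalMaxDensity (dual H) Y X B A (inv α)
    last-piece-dual-maximal {X = X} {Y = Y} {L = L} {A = A} {B = B} {α = α} supp≢∅ s α<L α>0
      with last-piece {L = L} s
    ... | dsub , _ , wtA>0 , wtB≡ = (dsub , density , bound) , maximal
      where
      wtB>0 : 0ℚ < wt (wE H) B
      wtB>0 = subst (0ℚ <_) (sym wtB≡)
                (positive⁻¹ _ {{pos*pos⇒pos α {{positive α>0}} _ {{positive wtA>0}}}})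
      density : HasDensity (dual H) B A (inv α)
      density = wt-pos⇒Nonempty (wE H) wtB>0 , wtB>0 ,
                trans (sym (inv-cancelˡ α>0 _)) (cong (inv α *_) (sym wtB≡))
      bound : ∀ B′ A′ → IsSubgraphOf (dual H) Y X B′ A′ → Nonempty B′ →
              wt (wV H) A′ ≤ inv α * wt (wE H) B′
      bound B′ A′ dsub′ _ = begin
        wt (wV H) A′                ≡⟨ inv-cancelˡ α>0 _ ⟨
        inv α * (α * wt (wV H) A′)  ≤⟨ *-monoˡ-≤-nonNeg (inv α) {{inv≥0}} αA′≤B′ ⟩
        inv α * wt (wE H) B′        ∎
        where
        open ≤-Reasoning
        αA′≤B′ : α * wt (wV H) A′ ≤ wt (wE H) B′
        αA′≤B′ = dualSubgraph-weight-≥ α supp≢∅ s (All-≤-densities-∷ʳ {L = L} α<L) dsub′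
        inv≥0 : NonNegative (inv α)
        inv≥0 = nonNegative (<⇒≤ (inv-pos α>0))
      maximal : ∀ B′ A′ → IsMaxDensity (dual H) Y X B′ A′ (inv α) → B ⊆ B′ → A ⊆ A′ → B′ ≡ B × A′ ≡ A
      maximal B′ A′ (dsub′ , (_ , _ , wtA′≡) , _) B⊆B′ A⊆A′
        with dualSubgraph-weight-≡⇒⊆ {L = L} supp≢∅ s α<L dsub′
               (trans (cong (α *_) wtA′≡) (inv-cancelʳ α>0 _))
      ... | A′⊆A , B′⊆B = ⊆-antisym B′⊆B B⊆B′ , ⊆-antisym A′⊆A A⊆A′

    SpecDecFrom-dual : Reverse L → NonemptySupports X Y → SpecDecFrom H X Y L →
                       StrictlyDecreasing (densities H L) → All (0ℚ <_) (densities H L) →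
                       SpecDecFrom (dual H) Y X (reverse (map (dualPiece {H}) L))
    SpecDecFrom-dual [] _ (X≡⊥ , Y≡⊥) _ _ = Y≡⊥ , X≡⊥
    SpecDecFrom-dual (L ∶ r ∶ʳ (A , B , α)) supp≢∅ s dec pos
      rewrite reverse-map-∷ʳ (dualPiece {H}) L (A , B , α)
      with StrictlyDecreasing-∷ʳ⁻ _ α (subst StrictlyDecreasing (densities-∷ʳ L) dec)
         | ∷ʳ⁻ (subst (All (0ℚ <_)) (densities-∷ʳ L) pos)
    ... | decL , α<L | posL , α>0 =
      last-piece-dual-maximal {L = L} supp≢∅ s α<L α>0 ,
      SpecDecFrom-dual r (NonemptySupports-─-dualSubgraph supp≢∅ (proj₁ (last-piece {L = L} s)))
                         (SpecDecFrom-∷ʳ⁻ {L = L} s) decL posL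

theorem8 : (H : Hypergraph) → PositiveWeights H →
    (∀ v → ∃ λ e → v ∈ supp H e) →
    (∀ e → Nonempty (supp H e)) →
    (L : List (Piece H)) → SpectralDecomposition H L →
    StrictlyDecreasing (densities H L) → All (0ℚ <_) (densities H L) →
    SpectralDecomposition (dual H) (reverse (map (dualPiece {H}) L)) ×
    StrictlyDecreasing (densities (dual H) (reverse (map (dualPiece {H}) L))) ×
    All (0ℚ <_) (densities (dual H) (reverse (map (dualPiece {H}) L)))
theorem8 H pw _ supp≢∅ L s dec pos =
  SpecDecFrom-dual H pw (reverseView L) nonemptySupports s dec pos ,
  subst StrictlyDecreasing (sym (densities-dual H L))
    (inv-reverse-StrictlyDecreasing (reverseView _) dec pos) ,
  subst (All (0ℚ <_)) (sym (densities-dual H L)) (All-reverse (map⁺ (All.map inv-pos pos)))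
  where
  nonemptySupports : NonemptySupports H ⊤ ⊤
  nonemptySupports {e} _ with supp≢∅ e
  ... | v , v∈e = v , x∈p∩q⁺ (v∈e , ∈⊤)
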